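{- Let $G$ be a singular simple graph whose set of core vertices is independent. Let $u$ and $w$ be core-forbidden vertices of $G$ with $u\not\sim w$, and let $G+e$ be obtained by adding the edge $e=\{u,w\}$. Then $\eta(G+e)=\eta(G)$ if and only if $CV(G)=CV(G+e)$.
   Context: $\eta(G)=\dim\ker\mathbf{A}$ for the $\{0,1\}$-adjacency matrix $\mathbf{A}$; $G$ is singular if $\eta(G)>0$. A vertex $v$ is a core vertex if some $\mathbf{x}\in\ker\mathbf{A}$ has $x_v\neq0$ and core-forbidden otherwise; $CV(H)$ denotes the set of core vertices of a graph $H$. -}

module Defs where

open import Data.Nat using (ℕ; zero; suc)
open import Data.Fin using (Fin; zero; suc; _≟_)
open import Data.Bool using (Bool; true; false; _∨_; _∧_; if_then_else_)
open import Data.Rational using (ℚ; 0ℚ; 1ℚ; _+_; _*_)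
open import Data.Product using (Σ; ∃; _×_)
open import Relation.Nullary using (¬_)
open import Relation.Nullary.Decidable using (⌊_⌋)
open import Relation.Binary.PropositionalEquality using (_≡_; _≢_)

Graph : ℕ → Set
Graph n = Fin n → Fin n → Bool

IsSimple : ∀ {n} → Graph n → Set
IsSimple {n} G = (∀ (i j : Fin n) → G i j ≡ G j i) × (∀ (i : Fin n) → G i i ≡ false)

Σℚ : ∀ k → (Fin k → ℚ) → ℚ
Σℚ zero    f = 0ℚ
Σℚ (suc k) f = f zero + Σℚ k (λ i → f (suc i))

A : ∀ {n} → Graph n → Fin n → Fin n → ℚ
A G i j = if G i j then 1ℚ else 0ℚ

InKer : ∀ {n} → Graph n → (Fin n → ℚ) → Set
InKer {n} G x = ∀ (i : Fin n) → Σℚ n (λ j → A G i j * x j) ≡ 0ℚ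

Nullity : ∀ {n} → Graph n → ℕ → Set
Nullity {n} G k = Σ (Fin k → Fin n → ℚ) λ b →
    (∀ (j : Fin k) → InKer G (b j))
  × (∀ (c : Fin k → ℚ) → (∀ (i : Fin n) → Σℚ k (λ j → c j * b j i) ≡ 0ℚ) → ∀ (j : Fin k) → c j ≡ 0ℚ)
  × (∀ (x : Fin n → ℚ) → InKer G x → ∃ λ (c : Fin k → ℚ) → ∀ (i : Fin n) → x i ≡ Σℚ k (λ j → c j * b j i))

Singular : ∀ {n} → Graph n → Set
Singular {n} G = ∃ λ (x : Fin n → ℚ) → InKer G x × ∃ λ (v : Fin n) → x v ≢ 0ℚ

Core : ∀ {n} → Graph n → Fin n → Set
Core {n} G v = ∃ λ (x : Fin n → ℚ) → InKer G x × x v ≢ 0ℚ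

CoreForbidden : ∀ {n} → Graph n → Fin n → Set
CoreForbidden G v = ¬ Core G v

CoreIndependent : ∀ {n} → Graph n → Set
CoreIndependent {n} G = ∀ (v w : Fin n) → Core G v → Core G w → G v w ≡ false

addEdge : ∀ {n} → Graph n → Fin n → Fin n → Graph n
addEdge G u w i j = G i j ∨ (⌊ i ≟ u ⌋ ∧ ⌊ j ≟ w ⌋) ∨ (⌊ i ≟ w ⌋ ∧ ⌊ j ≟ u ⌋)

-- Since u and w are core-forbidden, every vector of ker A(G) vanishes at u and w, and on such vectors
-- A(G) and A(G + e) agree; so ker A(G) ⊆ ker A(G + e). If the nullities are equal this inclusion is an
-- equality (k + 1 vectors in a space spanned by k vectors are dependent), hence the core sets agree.
-- Conversely, if the core sets agree then u and w are core-forbidden in G + e as well, the same argument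
-- gives the reverse inclusion, and a basis of ker A(G), produced by Gaussian elimination, serves for both.
module Submission where

open import Defs
open import Data.Nat using (ℕ)
open import Data.Fin using (Fin)
open import Data.Bool using (false)
open import Data.Product using (∃; _×_)
open import Function.Bundles using (_⇔_)
open import Relation.Binary.PropositionalEquality using (_≡_; _≢_)

open import Level using (0ℓ)
open import Algebra.Bundles using (CommutativeRing)
open import Data.Bool using (if_then_else_; _∨_; _∧_)
open import Data.Bool.Properties using (∧-zeroʳ; ∨-identityʳ)
open import Data.Empty using (⊥-elim)
open import Data.Fin using (zero; suc; punchIn) renaming (_≟_ to _≟ᶠ_)
open import Data.Fin.Properties using (punchInᵢ≢i; all?; ¬∀⟶∃¬)
open import Data.Nat using (zero; suc; _≤_; _+_; z≤n)
open import Data.Nat.Properties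
  using (≤-refl; ≤-reflexive; ≤-trans; +-monoʳ-≤; +-suc; n≤1+n; +-identityʳ; <-irrefl)
open import Data.Product using (_,_; proj₁; proj₂; ∃₂)
open import Data.Rational using (ℚ; 0ℚ; 1ℚ; _*_; -_; 1/_; NonZero; ≢-nonZero) renaming (_+_ to _+ℚ_)
import Data.Rational.Properties as ℚ
open import Data.Rational.Solver using (module +-*-Solver)
open import Data.Vec.Functional using (Vector; removeAt; insertAt; _∷_)
open import Data.Vec.Functional.Properties using (insertAt-lookup; insertAt-punchIn; insertAt-removeAt)
open import Function using (_∘_)
open import Function.Bundles using (mk⇔; module Equivalence)
open import Relation.Nullary using (Dec; yes; no; does)
open import Relation.Nullary.Decidable using (⌊_⌋; dec-true; dec-false; isYes≗does; decidable-stable)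
open import Relation.Unary using (Pred; _⊆_; _≐_)
open import Relation.Binary.PropositionalEquality using (refl; sym; trans; cong; cong₂; _≗_; module ≡-Reasoning)

open import Algebra.Properties.Semiring.Sum (CommutativeRing.semiring ℚ.+-*-commutativeRing)
  using (sum; sum-cong-≗; ∑-distrib-+; ∑-comm; sum-remove; *-distribˡ-sum; *-distribʳ-sum; sum-replicate-zero)
open import Algebra.Properties.Group ℚ.+-0-group using (inverseʳ-unique)
open Equivalence using (to; from)
open +-*-Solver
open ≡-Reasoning

infix 7 _·_

_·_ : ∀ {n} → Vector ℚ n → Vector ℚ n → ℚ
r · x = sum (λ i → r i * x i)

lincomb : ∀ {k n} → Vector ℚ k → (Fin k → Vector ℚ n) → Vector ℚ n
lincomb c b i = sum (λ j → c j * b j i)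

Sol : ∀ {m n} → (Fin m → Vector ℚ n) → Pred (Vector ℚ n) 0ℓ
Sol R x = ∀ r → R r · x ≡ 0ℚ

Independent : ∀ {k n} → (Fin k → Vector ℚ n) → Set
Independent b = ∀ c → (∀ i → lincomb c b i ≡ 0ℚ) → ∀ j → c j ≡ 0ℚ

Spans : ∀ {ℓ k n} → Pred (Vector ℚ n) ℓ → (Fin k → Vector ℚ n) → Set ℓ
Spans P b = ∀ {x} → P x → ∃ λ c → x ≗ lincomb c b

record IsBasis {ℓ k n} (P : Pred (Vector ℚ n) ℓ) (b : Fin k → Vector ℚ n) : Set ℓ where
  constructor isBasis
  field
    members     : ∀ j → P (b j)
    independent : Independent b
    spans       : Spans P b

IsBasis-cong : ∀ {ℓ₁ ℓ₂ k n} {P : Pred (Vector ℚ n) ℓ₁} {Q : Pred (Vector ℚ n) ℓ₂}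
  {b : Fin k → Vector ℚ n} → P ≐ Q → IsBasis P b → IsBasis Q b
IsBasis-cong (P⊆Q , Q⊆P) (isBasis b∈ indep span) = isBasis (P⊆Q ∘ b∈) indep (span ∘ Q⊆P)

sum-zero : ∀ {k} {f : Vector ℚ k} → (∀ j → f j ≡ 0ℚ) → sum f ≡ 0ℚ
sum-zero {k} f≡0 = trans (sum-cong-≗ f≡0) (sum-replicate-zero k)

sum-supported-at : ∀ {k} {f : Vector ℚ (suc k)} i → (∀ j → j ≢ i → f j ≡ 0ℚ) → sum f ≡ f i
sum-supported-at {f = f} i off = begin
  sum f                        ≡⟨ sum-remove {i = i} f ⟩
  f i +ℚ sum (removeAt f i)    ≡⟨ cong (f i +ℚ_) (sum-zero (λ q → off _ (punchInᵢ≢i i q))) ⟩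
  f i +ℚ 0ℚ                    ≡⟨ ℚ.+-identityʳ (f i) ⟩
  f i                          ∎

lincomb-congˡ : ∀ {k n} {c d : Vector ℚ k} (b : Fin k → Vector ℚ n) → c ≗ d → lincomb c b ≗ lincomb d b
lincomb-congˡ b c≗d i = sum-cong-≗ (λ j → cong (_* b j i) (c≗d j))

lincomb-zero : ∀ {k n} {c : Vector ℚ k} (b : Fin k → Vector ℚ n) → (∀ j → c j ≡ 0ℚ) →
  ∀ i → lincomb c b i ≡ 0ℚ
lincomb-zero b c≡0 i = sum-zero (λ j → trans (cong (_* b j i) (c≡0 j)) (ℚ.*-zeroˡ (b j i)))

lincomb-scale : ∀ {k n} t (c : Vector ℚ k) (b : Fin k → Vector ℚ n) i →
  lincomb (λ j → t * c j) b i ≡ t * lincomb c b i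
lincomb-scale t c b i = begin
  sum (λ j → t * c j * b j i)    ≡⟨ sum-cong-≗ (λ j → ℚ.*-assoc t (c j) (b j i)) ⟩
  sum (λ j → t * (c j * b j i))  ≡⟨ sym (*-distribˡ-sum t (λ j → c j * b j i)) ⟩
  t * lincomb c b i              ∎

lincomb-insertAt : ∀ {k n} (c : Vector ℚ k) p β (b : Fin (suc k) → Vector ℚ n) i →
  lincomb (insertAt c p β) b i ≡ β * b p i +ℚ lincomb c (removeAt b p) i
lincomb-insertAt c p β b i = trans (sum-remove {i = p} (λ j → insertAt c p β j * b j i))
  (cong₂ _+ℚ_ (cong (_* b p i) (insertAt-lookup c p β))
              (sum-cong-≗ (λ q → cong (_* b (punchIn p q) i) (insertAt-punchIn c p β q))))

lincomb-lincomb : ∀ {l k n} (c : Vector ℚ l) (M : Fin l → Vector ℚ k) (b : Fin k → Vector ℚ n) →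
  lincomb c (λ a → lincomb (M a) b) ≗ lincomb (λ j → sum (λ a → c a * M a j)) b
lincomb-lincomb c M b i = begin
  sum (λ a → c a * sum (λ j → M a j * b j i))
    ≡⟨ sum-cong-≗ (λ a → *-distribˡ-sum (c a) (λ j → M a j * b j i)) ⟩
  sum (λ a → sum (λ j → c a * (M a j * b j i)))
    ≡⟨ ∑-comm (λ a j → c a * (M a j * b j i)) ⟩
  sum (λ j → sum (λ a → c a * (M a j * b j i)))
    ≡⟨ sum-cong-≗ (λ j → sum-cong-≗ (λ a → sym (ℚ.*-assoc (c a) (M a j) (b j i)))) ⟩
  sum (λ j → sum (λ a → c a * M a j * b j i))
    ≡⟨ sum-cong-≗ (λ j → sym (*-distribʳ-sum (b j i) (λ a → c a * M a j))) ⟩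
  sum (λ j → sum (λ a → c a * M a j) * b j i)
    ∎

·-lincomb : ∀ {k n} (r : Vector ℚ n) (c : Vector ℚ k) (b : Fin k → Vector ℚ n) →
  r · lincomb c b ≡ sum (λ j → c j * (r · b j))
·-lincomb r c b = begin
  sum (λ i → r i * sum (λ j → c j * b j i))
    ≡⟨ sum-cong-≗ (λ i → *-distribˡ-sum (r i) (λ j → c j * b j i)) ⟩
  sum (λ i → sum (λ j → r i * (c j * b j i)))
    ≡⟨ ∑-comm (λ i j → r i * (c j * b j i)) ⟩
  sum (λ j → sum (λ i → r i * (c j * b j i)))
    ≡⟨ sum-cong-≗ (λ j → sum-cong-≗ (λ i → swap (r i) (c j) (b j i))) ⟩
  sum (λ j → sum (λ i → c j * (r i * b j i)))
    ≡⟨ sum-cong-≗ (λ j → sym (*-distribˡ-sum (c j) (λ i → r i * b j i))) ⟩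
  sum (λ j → c j * (r · b j))
    ∎
  where
  swap : ∀ x y z → x * (y * z) ≡ y * (x * z)
  swap = solve 3 (λ x y z → x :* (y :* z) := y :* (x :* z)) refl

·-axpy : ∀ {n} (r x y : Vector ℚ n) t → r · (λ i → x i +ℚ t * y i) ≡ r · x +ℚ t * (r · y)
·-axpy r x y t = begin
  sum (λ i → r i * (x i +ℚ t * y i))
    ≡⟨ sum-cong-≗ (λ i → expand (r i) (x i) t (y i)) ⟩
  sum (λ i → r i * x i +ℚ t * (r i * y i))
    ≡⟨ ∑-distrib-+ (λ i → r i * x i) (λ i → t * (r i * y i)) ⟩
  r · x +ℚ sum (λ i → t * (r i * y i))
    ≡⟨ cong (r · x +ℚ_) (sym (*-distribˡ-sum t (λ i → r i * y i))) ⟩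
  r · x +ℚ t * (r · y)
    ∎
  where
  expand : ∀ a x t y → a * (x +ℚ t * y) ≡ a * x +ℚ t * (a * y)
  expand = solve 4 (λ a x t y → a :* (x :+ t :* y) := a :* x :+ t :* (a :* y)) refl

Sol-resp-≗ : ∀ {m n} (R : Fin m → Vector ℚ n) {x y} → x ≗ y → Sol R y → Sol R x
Sol-resp-≗ R x≗y y∈ r = trans (sum-cong-≗ (λ i → cong (R r i *_) (x≗y i))) (y∈ r)

Sol-lincomb : ∀ {m n k} (R : Fin m → Vector ℚ n) c {b : Fin k → Vector ℚ n} →
  (∀ j → Sol R (b j)) → Sol R (lincomb c b)
Sol-lincomb R c {b} b∈ r = trans (·-lincomb (R r) c b)
  (sum-zero (λ j → trans (cong (c j *_) (b∈ j r)) (ℚ.*-zeroʳ (c j))))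

δ : ∀ {n} → Fin n → Vector ℚ n
δ i j = if does (i ≟ᶠ j) then 1ℚ else 0ℚ

δ-diag : ∀ {n} (i : Fin n) → δ i i ≡ 1ℚ
δ-diag i = cong (if_then 1ℚ else 0ℚ) (dec-true (i ≟ᶠ i) refl)

δ-off : ∀ {n} {i j : Fin n} → i ≢ j → δ i j ≡ 0ℚ
δ-off {i = i} {j} i≢j = cong (if_then 1ℚ else 0ℚ) (dec-false (i ≟ᶠ j) i≢j)

lincomb-δˡ : ∀ {k n} (b : Fin k → Vector ℚ n) j → lincomb (δ j) b ≗ b j
lincomb-δˡ {suc k} b j i = begin
  sum (λ l → δ j l * b l i)  ≡⟨ sum-supported-at j off ⟩
  δ j j * b j i              ≡⟨ cong (_* b j i) (δ-diag j) ⟩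
  1ℚ * b j i                 ≡⟨ ℚ.*-identityˡ (b j i) ⟩
  b j i                      ∎
  where
  off : ∀ l → l ≢ j → δ j l * b l i ≡ 0ℚ
  off l l≢j = trans (cong (_* b l i) (δ-off (l≢j ∘ sym))) (ℚ.*-zeroˡ (b l i))

lincomb-δʳ : ∀ {n} (c : Vector ℚ n) → lincomb c δ ≗ c
lincomb-δʳ {suc n} c i = begin
  sum (λ j → c j * δ j i)  ≡⟨ sum-supported-at i off ⟩
  c i * δ i i              ≡⟨ cong (c i *_) (δ-diag i) ⟩
  c i * 1ℚ                 ≡⟨ ℚ.*-identityʳ (c i) ⟩
  c i                      ∎
  where
  off : ∀ j → j ≢ i → c j * δ j i ≡ 0ℚ
  off j j≢i = trans (cong (c j *_) (δ-off j≢i)) (ℚ.*-zeroʳ (c j))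

δ-isBasis : ∀ {n} (R : Fin 0 → Vector ℚ n) → IsBasis (Sol R) δ
δ-isBasis R = isBasis (λ _ ())
                      (λ c c·δ≡0 j → trans (sym (lincomb-δʳ c j)) (c·δ≡0 j))
                      (λ {x} _ → x , λ i → sym (lincomb-δʳ x i))

independent⇒nonzero : ∀ {k n} (b : Fin k → Vector ℚ n) → Independent b → ∀ j → ∃ λ i → b j i ≢ 0ℚ
independent⇒nonzero {n = n} b indep j = ¬∀⟶∃¬ n _ (λ i → b j i ℚ.≟ 0ℚ) λ bⱼ≡0 →
  1≢0 (trans (sym (δ-diag j)) (indep (δ j) (λ i → trans (lincomb-δˡ b j i) (bⱼ≡0 i)) j))
  where
  1≢0 : 1ℚ ≢ 0ℚ
  1≢0 ()

-- One step of Gaussian elimination: b p pivots the new equation R zero out of the other basis vectors,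
-- the multiplier μ q being chosen so that R zero · pivoted q = 0.
module Pivot {m n k} (R : Fin (suc m) → Vector ℚ n) (b : Fin (suc k) → Vector ℚ n)
             (p : Fin (suc k)) (Rb≢0 : R zero · b p ≢ 0ℚ) where

  a : Vector ℚ (suc k)
  a j = R zero · b j

  instance
    a-nonZero : NonZero (a p)
    a-nonZero = ≢-nonZero Rb≢0

  μ : Vector ℚ k
  μ q = - (a (punchIn p q) * 1/ a p)

  pivoted : Fin k → Vector ℚ n
  pivoted q i = b (punchIn p q) i +ℚ μ q * b p i

  lincomb-pivoted : ∀ c → lincomb c pivoted ≗ lincomb (insertAt c p (sum (λ q → c q * μ q))) b
  lincomb-pivoted c i = begin
    sum (λ q → c q * pivoted q i)
      ≡⟨ sum-cong-≗ (λ q → expand (c q) (b (punchIn p q) i) (μ q) (b p i)) ⟩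
    sum (λ q → c q * b (punchIn p q) i +ℚ c q * μ q * b p i)
      ≡⟨ ∑-distrib-+ (λ q → c q * b (punchIn p q) i) (λ q → c q * μ q * b p i) ⟩
    lincomb c (removeAt b p) i +ℚ sum (λ q → c q * μ q * b p i)
      ≡⟨ cong (lincomb c (removeAt b p) i +ℚ_) (sym (*-distribʳ-sum (b p i) (λ q → c q * μ q))) ⟩
    lincomb c (removeAt b p) i +ℚ β * b p i
      ≡⟨ ℚ.+-comm (lincomb c (removeAt b p) i) (β * b p i) ⟩
    β * b p i +ℚ lincomb c (removeAt b p) i
      ≡⟨ sym (lincomb-insertAt c p β b i) ⟩
    lincomb (insertAt c p β) b i
      ∎
    where
    β : ℚ
    β = sum (λ q → c q * μ q)
    expand : ∀ c x t y → c * (x +ℚ t * y) ≡ c * x +ℚ c * t * y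
    expand = solve 4 (λ c x t y → c :* (x :+ t :* y) := c :* x :+ c :* t :* y) refl

  μ-recovers-pivot-coefficient : ∀ (e : Vector ℚ (suc k)) → sum (λ j → e j * a j) ≡ 0ℚ →
    sum (λ q → e (punchIn p q) * μ q) ≡ e p
  μ-recovers-pivot-coefficient e e⊥a = begin
    sum (λ q → e (punchIn p q) * μ q)
      ≡⟨ sum-cong-≗ (λ q → regroup (e (punchIn p q)) (a (punchIn p q)) (1/ a p)) ⟩
    sum (λ q → - (1/ a p) * (e (punchIn p q) * a (punchIn p q)))
      ≡⟨ sym (*-distribˡ-sum (- (1/ a p)) (λ q → e (punchIn p q) * a (punchIn p q))) ⟩
    - (1/ a p) * sum (λ q → e (punchIn p q) * a (punchIn p q))
      ≡⟨ cong (- (1/ a p) *_) others≡ ⟩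
    - (1/ a p) * - (e p * a p)
      ≡⟨ cancel (1/ a p) (e p) (a p) ⟩
    e p * (1/ a p * a p)
      ≡⟨ cong (e p *_) (ℚ.*-inverseˡ (a p)) ⟩
    e p * 1ℚ
      ≡⟨ ℚ.*-identityʳ (e p) ⟩
    e p
      ∎
    where
    others≡ : sum (λ q → e (punchIn p q) * a (punchIn p q)) ≡ - (e p * a p)
    others≡ = inverseʳ-unique (e p * a p) _ (trans (sym (sum-remove {i = p} (λ j → e j * a j))) e⊥a)
    regroup : ∀ x y z → x * - (y * z) ≡ - z * (x * y)
    regroup = solve 3 (λ x y z → x :* :- (y :* z) := :- z :* (x :* y)) refl
    cancel : ∀ z x y → - z * - (x * y) ≡ x * (z * y)
    cancel = solve 3 (λ z x y → :- z :* :- (x :* y) := x :* (z :* y)) refl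

  pivoted-∈ : (∀ j → Sol (R ∘ suc) (b j)) → ∀ q → Sol R (pivoted q)
  pivoted-∈ b∈ q zero = begin
    R zero · pivoted q
      ≡⟨ ·-axpy (R zero) (b (punchIn p q)) (b p) (μ q) ⟩
    a (punchIn p q) +ℚ μ q * a p
      ≡⟨ regroup (a (punchIn p q)) (1/ a p) (a p) ⟩
    a (punchIn p q) +ℚ - (a (punchIn p q) * (1/ a p * a p))
      ≡⟨ cong (λ t → a (punchIn p q) +ℚ - (a (punchIn p q) * t)) (ℚ.*-inverseˡ (a p)) ⟩
    a (punchIn p q) +ℚ - (a (punchIn p q) * 1ℚ)
      ≡⟨ cong (λ t → a (punchIn p q) +ℚ - t) (ℚ.*-identityʳ (a (punchIn p q))) ⟩
    a (punchIn p q) +ℚ - a (punchIn p q)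
      ≡⟨ ℚ.+-inverseʳ (a (punchIn p q)) ⟩
    0ℚ
      ∎
    where
    regroup : ∀ x z y → x +ℚ - (x * z) * y ≡ x +ℚ - (x * (z * y))
    regroup = solve 3 (λ x z y → x :+ :- (x :* z) :* y := x :+ :- (x :* (z :* y))) refl
  pivoted-∈ b∈ q (suc r) = begin
    R (suc r) · pivoted q
      ≡⟨ ·-axpy (R (suc r)) (b (punchIn p q)) (b p) (μ q) ⟩
    R (suc r) · b (punchIn p q) +ℚ μ q * (R (suc r) · b p)
      ≡⟨ cong₂ (λ s t → s +ℚ μ q * t) (b∈ (punchIn p q) r) (b∈ p r) ⟩
    0ℚ +ℚ μ q * 0ℚ
      ≡⟨ cong (0ℚ +ℚ_) (ℚ.*-zeroʳ (μ q)) ⟩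
    0ℚ
      ∎

  pivoted-independent : Independent b → Independent pivoted
  pivoted-independent indep c c·pivoted≡0 q = begin
    c q                            ≡⟨ sym (insertAt-punchIn c p β q) ⟩
    insertAt c p β (punchIn p q)   ≡⟨ indep (insertAt c p β) c′·b≡0 (punchIn p q) ⟩
    0ℚ                             ∎
    where
    β : ℚ
    β = sum (λ q → c q * μ q)
    c′·b≡0 : ∀ i → lincomb (insertAt c p β) b i ≡ 0ℚ
    c′·b≡0 i = trans (sym (lincomb-pivoted c i)) (c·pivoted≡0 i)

  pivoted-spans : Spans (Sol (R ∘ suc)) b → Spans (Sol R) pivoted
  pivoted-spans span {x} x∈ = removeAt e p , λ i → begin
    x i
      ≡⟨ x≗e·b i ⟩
    lincomb e b i
      ≡⟨ lincomb-congˡ b (λ j → sym (insertAt-removeAt e p j)) i ⟩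
    lincomb (insertAt (removeAt e p) p (e p)) b i
      ≡⟨ cong (λ t → lincomb (insertAt (removeAt e p) p t) b i) (sym (μ-recovers-pivot-coefficient e e⊥a)) ⟩
    lincomb (insertAt (removeAt e p) p (sum (λ q → e (punchIn p q) * μ q))) b i
      ≡⟨ sym (lincomb-pivoted (removeAt e p) i) ⟩
    lincomb (removeAt e p) pivoted i
      ∎
    where
    e : Vector ℚ (suc k)
    e = proj₁ (span (x∈ ∘ suc))
    x≗e·b : x ≗ lincomb e b
    x≗e·b = proj₂ (span (x∈ ∘ suc))
    e⊥a : sum (λ j → e j * a j) ≡ 0ℚ
    e⊥a = trans (sym (·-lincomb (R zero) e b)) (Sol-resp-≗ R (sym ∘ x≗e·b) x∈ zero)

  pivoted-isBasis : IsBasis (Sol (R ∘ suc)) b → IsBasis (Sol R) pivoted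
  pivoted-isBasis (isBasis b∈ indep span) =
    isBasis (pivoted-∈ b∈) (pivoted-independent indep) (pivoted-spans span)

orthogonal-isBasis : ∀ {m n k} (R : Fin (suc m) → Vector ℚ n) {b : Fin k → Vector ℚ n} →
  (∀ j → R zero · b j ≡ 0ℚ) → IsBasis (Sol (R ∘ suc)) b → IsBasis (Sol R) b
orthogonal-isBasis R {b} R⊥b (isBasis b∈ indep span) = isBasis b∈′ indep (λ x∈ → span (x∈ ∘ suc))
  where
  b∈′ : ∀ j → Sol R (b j)
  b∈′ j zero    = R⊥b j
  b∈′ j (suc r) = b∈ j r

addEquation-isBasis : ∀ {m n k} (R : Fin (suc m) → Vector ℚ n) {b : Fin k → Vector ℚ n} →
  IsBasis (Sol (R ∘ suc)) b → ∃₂ λ k′ (b′ : Fin k′ → Vector ℚ n) → k ≤ suc k′ × IsBasis (Sol R) b′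
addEquation-isBasis {k = zero} R β = zero , _ , z≤n , orthogonal-isBasis R (λ ()) β
addEquation-isBasis {k = suc k} R {b} β with all? (λ j → R zero · b j ℚ.≟ 0ℚ)
... | yes R⊥b = suc k , b , n≤1+n (suc k) , orthogonal-isBasis R R⊥b β
... | no R̸⊥b with ¬∀⟶∃¬ (suc k) _ (λ j → R zero · b j ℚ.≟ 0ℚ) R̸⊥b
...   | p , Rbₚ≢0 = k , pivoted , ≤-refl , pivoted-isBasis β
  where open Pivot R b p Rbₚ≢0

solutionBasis : ∀ m {n} (R : Fin m → Vector ℚ n) →
  ∃₂ λ k (b : Fin k → Vector ℚ n) → n ≤ m + k × IsBasis (Sol R) b
solutionBasis zero {n} R = n , δ , ≤-refl , δ-isBasis R
solutionBasis (suc m) R with solutionBasis m (R ∘ suc)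
... | k , b , n≤m+k , β with addEquation-isBasis R β
...   | k′ , b′ , k≤1+k′ , β′ = k′ , b′ , n≤1+m+k′ , β′
  where
  n≤1+m+k′ : _ ≤ suc m + k′
  n≤1+m+k′ = ≤-trans n≤m+k (≤-trans (+-monoʳ-≤ m k≤1+k′) (≤-reflexive (+-suc m k′)))

Sol-nontrivial : ∀ k (M : Fin k → Vector ℚ (suc k)) → ∃ λ c → (∃ λ a → c a ≢ 0ℚ) × Sol M c
Sol-nontrivial k M with solutionBasis k M
... | zero , _ , 1+k≤k+0 , _ = ⊥-elim (<-irrefl refl (≤-trans 1+k≤k+0 (≤-reflexive (+-identityʳ k))))
... | suc _ , b , _ , isBasis b∈ indep _ = b zero , independent⇒nonzero b indep zero , b∈ zero

spanned-dependent : ∀ {ℓ k n} {Q : Pred (Vector ℚ n) ℓ} {b : Fin k → Vector ℚ n} → Spans Q b →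
  (V : Fin (suc k) → Vector ℚ n) → (∀ a → Q (V a)) →
  ∃ λ c → (∃ λ a → c a ≢ 0ℚ) × (∀ i → lincomb c V i ≡ 0ℚ)
spanned-dependent {k = k} {b = b} span V V∈ with Sol-nontrivial k (λ j a → proj₁ (span (V∈ a)) j)
... | c , c≢0 , c∈ = c , c≢0 , λ i → begin
  lincomb c V i                                ≡⟨ sum-cong-≗ (λ a → cong (c a *_) (V≗M·b a i)) ⟩
  lincomb c (λ a → lincomb (M a) b) i          ≡⟨ lincomb-lincomb c M b i ⟩
  lincomb (λ j → sum (λ a → c a * M a j)) b i  ≡⟨ lincomb-zero b c·M≡0 i ⟩
  0ℚ                                           ∎
  where
  M : Fin (suc k) → Vector ℚ k
  M a = proj₁ (span (V∈ a))
  V≗M·b : ∀ a → V a ≗ lincomb (M a) b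
  V≗M·b a = proj₂ (span (V∈ a))
  c·M≡0 : ∀ j → sum (λ a → c a * M a j) ≡ 0ℚ
  c·M≡0 j = trans (sum-cong-≗ (λ a → ℚ.*-comm (c a) (M a j))) (c∈ j)

independent-∷-relation : ∀ {k n} {b : Fin k → Vector ℚ n} → Independent b → ∀ y (c : Vector ℚ (suc k)) →
  (∀ i → lincomb c (y ∷ b) i ≡ 0ℚ) → c zero ≡ 0ℚ → ∀ a → c a ≡ 0ℚ
independent-∷-relation         indep y c c·V≡0 c₀≡0 zero    = c₀≡0
independent-∷-relation {b = b} indep y c c·V≡0 c₀≡0 (suc j) = indep (c ∘ suc) rest≡0 j
  where
  rest≡0 : ∀ i → lincomb (c ∘ suc) b i ≡ 0ℚ
  rest≡0 i = begin
    lincomb (c ∘ suc) b i                  ≡⟨ ℚ.+-identityˡ (lincomb (c ∘ suc) b i) ⟨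
    0ℚ +ℚ lincomb (c ∘ suc) b i            ≡⟨ cong (_+ℚ lincomb (c ∘ suc) b i) c₀yᵢ≡0 ⟨
    c zero * y i +ℚ lincomb (c ∘ suc) b i  ≡⟨ c·V≡0 i ⟩
    0ℚ                                     ∎
    where
    c₀yᵢ≡0 : c zero * y i ≡ 0ℚ
    c₀yᵢ≡0 = trans (cong (_* y i) c₀≡0) (ℚ.*-zeroˡ (y i))

∷-relation⇒lincomb : ∀ {k n} (b : Fin k → Vector ℚ n) y (c : Vector ℚ (suc k)) .{{_ : NonZero (c zero)}} →
  (∀ i → lincomb c (y ∷ b) i ≡ 0ℚ) → y ≗ lincomb (λ j → - (1/ c zero) * c (suc j)) b
∷-relation⇒lincomb b y c c·V≡0 i = begin
  y i                                            ≡⟨ ℚ.*-identityˡ (y i) ⟨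
  1ℚ * y i                                       ≡⟨ cong (_* y i) (ℚ.*-inverseˡ (c zero)) ⟨
  1/ c zero * c zero * y i                       ≡⟨ negate (1/ c zero) (c zero) (y i) ⟩
  - (1/ c zero) * - (c zero * y i)               ≡⟨ cong (- (1/ c zero) *_) rest≡ ⟨
  - (1/ c zero) * lincomb (c ∘ suc) b i          ≡⟨ lincomb-scale (- (1/ c zero)) (c ∘ suc) b i ⟨
  lincomb (λ j → - (1/ c zero) * c (suc j)) b i  ∎
  where
  rest≡ : lincomb (c ∘ suc) b i ≡ - (c zero * y i)
  rest≡ = inverseʳ-unique (c zero * y i) (lincomb (c ∘ suc) b i) (c·V≡0 i)
  negate : ∀ z x y → z * x * y ≡ - z * - (x * y)
  negate = solve 3 (λ z x y → z :* x :* y := :- z :* :- (x :* y)) refl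

⊆∧equal-dim⇒⊇ : ∀ {ℓ m n k} {R : Fin m → Vector ℚ n} {Q : Pred (Vector ℚ n) ℓ} {b b′ : Fin k → Vector ℚ n} →
  IsBasis (Sol R) b → Spans Q b′ → Sol R ⊆ Q → Q ⊆ Sol R
⊆∧equal-dim⇒⊇ {R = R} {Q} {b} (isBasis b∈ indep _) span R⊆Q {y} y∈
  with spanned-dependent span (y ∷ b) V∈
  where
  V∈ : ∀ a → Q ((y ∷ b) a)
  V∈ zero    = y∈
  V∈ (suc j) = R⊆Q (b∈ j)
... | c , (a , cₐ≢0) , c·V≡0 with c zero ℚ.≟ 0ℚ
...   | yes c₀≡0 = ⊥-elim (cₐ≢0 (independent-∷-relation indep y c c·V≡0 c₀≡0 a))
...   | no c₀≢0  =
  Sol-resp-≗ R (∷-relation⇒lincomb b y c c·V≡0) (Sol-lincomb R (λ j → - (1/ c zero) * c (suc j)) b∈)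
  where
  instance
    c₀-nonZero : NonZero (c zero)
    c₀-nonZero = ≢-nonZero c₀≢0

Σℚ≗sum : ∀ k (f : Vector ℚ k) → Σℚ k f ≡ sum f
Σℚ≗sum zero    f = refl
Σℚ≗sum (suc k) f = cong (f zero +ℚ_) (Σℚ≗sum k (f ∘ suc))

Ker : ∀ {n} → Graph n → Pred (Vector ℚ n) 0ℓ
Ker G = Sol (A G)

InKer≐Ker : ∀ {n} (G : Graph n) → InKer G ≐ Ker G
InKer≐Ker {n} G = (λ {x} x∈ i → trans (sym (Σℚ≗sum n (λ j → A G i j * x j))) (x∈ i))
                , (λ {x} x∈ i → trans (Σℚ≗sum n (λ j → A G i j * x j)) (x∈ i))

Nullity⇔basis : ∀ {n} (G : Graph n) k → Nullity G k ⇔ (∃ λ (b : Fin k → Vector ℚ n) → IsBasis (Ker G) b)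
Nullity⇔basis G k = mk⇔
  (λ (b , b∈ , indep , span) → b , isBasis
    (proj₁ (InKer≐Ker G) ∘ b∈)
    (λ c c·b≡0 → indep c (λ i → trans (Σℚ≗sum k _) (c·b≡0 i)))
    (λ x∈ → let (c , x≗c·b) = span _ (proj₂ (InKer≐Ker G) x∈)
            in c , λ i → trans (x≗c·b i) (Σℚ≗sum k _)))
  (λ (b , isBasis b∈ indep span) → b
    , proj₂ (InKer≐Ker G) ∘ b∈
    , (λ c c·b≡0 → indep c (λ i → trans (sym (Σℚ≗sum k _)) (c·b≡0 i)))
    , (λ x x∈ → let (c , x≗c·b) = span (proj₁ (InKer≐Ker G) x∈)
                in c , λ i → trans (x≗c·b i) (sym (Σℚ≗sum k _))))

Core-cong : ∀ {n} (G H : Graph n) → Ker G ≐ Ker H → ∀ v → Core G v ⇔ Core H v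
Core-cong G H (G⊆H , H⊆G) v = mk⇔
  (λ (x , x∈ , xᵥ≢0) → x , proj₂ (InKer≐Ker H) (G⊆H (proj₁ (InKer≐Ker G) x∈)) , xᵥ≢0)
  (λ (x , x∈ , xᵥ≢0) → x , proj₂ (InKer≐Ker G) (H⊆G (proj₁ (InKer≐Ker H) x∈)) , xᵥ≢0)

forbidden⇒vanishes : ∀ {n} (G : Graph n) {v x} → CoreForbidden G v → Ker G x → x v ≡ 0ℚ
forbidden⇒vanishes G {v} {x} v-forbidden x∈ =
  decidable-stable (x v ℚ.≟ 0ℚ) (λ xᵥ≢0 → v-forbidden (x , proj₂ (InKer≐Ker G) x∈ , xᵥ≢0))

⌊≟⌋-false : ∀ {n} {i j : Fin n} → i ≢ j → ⌊ i ≟ᶠ j ⌋ ≡ false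
⌊≟⌋-false {i = i} {j} i≢j = trans (isYes≗does (i ≟ᶠ j)) (dec-false (i ≟ᶠ j) i≢j)

addEdge-off : ∀ {n} (G : Graph n) {u w} i {j} → j ≢ u → j ≢ w → addEdge G u w i j ≡ G i j
addEdge-off G {u} {w} i {j} j≢u j≢w = begin
  G i j ∨ (⌊ i ≟ᶠ u ⌋ ∧ ⌊ j ≟ᶠ w ⌋) ∨ (⌊ i ≟ᶠ w ⌋ ∧ ⌊ j ≟ᶠ u ⌋)
    ≡⟨ cong₂ (λ s t → G i j ∨ (⌊ i ≟ᶠ u ⌋ ∧ s) ∨ (⌊ i ≟ᶠ w ⌋ ∧ t)) (⌊≟⌋-false j≢w) (⌊≟⌋-false j≢u) ⟩
  G i j ∨ (⌊ i ≟ᶠ u ⌋ ∧ false) ∨ (⌊ i ≟ᶠ w ⌋ ∧ false)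
    ≡⟨ cong₂ (λ s t → G i j ∨ s ∨ t) (∧-zeroʳ ⌊ i ≟ᶠ u ⌋) (∧-zeroʳ ⌊ i ≟ᶠ w ⌋) ⟩
  G i j ∨ false
    ≡⟨ ∨-identityʳ (G i j) ⟩
  G i j
    ∎

A-addEdge-· : ∀ {n} (G : Graph n) {u w} {x : Vector ℚ n} → x u ≡ 0ℚ → x w ≡ 0ℚ →
  ∀ i → A (addEdge G u w) i · x ≡ A G i · x
A-addEdge-· G {u} {w} {x} xᵤ≡0 x_w≡0 i = sum-cong-≗ (λ j → termwise (j ≟ᶠ u) (j ≟ᶠ w))
  where
  vanishing : ∀ {j} → x j ≡ 0ℚ → A (addEdge G u w) i j * x j ≡ A G i j * x j
  vanishing {j} xⱼ≡0 = begin
    A (addEdge G u w) i j * x j  ≡⟨ cong (A (addEdge G u w) i j *_) xⱼ≡0 ⟩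
    A (addEdge G u w) i j * 0ℚ   ≡⟨ ℚ.*-zeroʳ (A (addEdge G u w) i j) ⟩
    0ℚ                           ≡⟨ ℚ.*-zeroʳ (A G i j) ⟨
    A G i j * 0ℚ                 ≡⟨ cong (A G i j *_) xⱼ≡0 ⟨
    A G i j * x j                ∎
  termwise : ∀ {j} → Dec (j ≡ u) → Dec (j ≡ w) → A (addEdge G u w) i j * x j ≡ A G i j * x j
  termwise (yes refl) _          = vanishing xᵤ≡0
  termwise (no _)     (yes refl) = vanishing x_w≡0
  termwise {j} (no j≢u) (no j≢w) = cong (λ e → (if e then 1ℚ else 0ℚ) * x j) (addEdge-off G i j≢u j≢w)

Ker-addEdge : ∀ {n} (G : Graph n) {u w} {x : Vector ℚ n} → x u ≡ 0ℚ → x w ≡ 0ℚ →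
  Ker G x ⇔ Ker (addEdge G u w) x
Ker-addEdge G xᵤ≡0 x_w≡0 = mk⇔
  (λ x∈ i → trans (A-addEdge-· G xᵤ≡0 x_w≡0 i) (x∈ i))
  (λ x∈ i → trans (sym (A-addEdge-· G xᵤ≡0 x_w≡0 i)) (x∈ i))

Ker⊆Ker-addEdge : ∀ {n} (G : Graph n) {u w} →
  CoreForbidden G u → CoreForbidden G w → Ker G ⊆ Ker (addEdge G u w)
Ker⊆Ker-addEdge G u-forbidden w-forbidden x∈ =
  to (Ker-addEdge G (forbidden⇒vanishes G u-forbidden x∈) (forbidden⇒vanishes G w-forbidden x∈)) x∈

Ker-addEdge⊆Ker : ∀ {n} (G : Graph n) {u w} →
  CoreForbidden (addEdge G u w) u → CoreForbidden (addEdge G u w) w → Ker (addEdge G u w) ⊆ Ker G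
Ker-addEdge⊆Ker G {u} {w} u-forbidden w-forbidden x∈ =
  from (Ker-addEdge G (forbidden⇒vanishes (addEdge G u w) u-forbidden x∈)
                      (forbidden⇒vanishes (addEdge G u w) w-forbidden x∈)) x∈

mainTheorem20 : ∀ (n : ℕ) (G : Graph n) (u w : Fin n) →
    IsSimple G → Singular G → CoreIndependent G →
    CoreForbidden G u → CoreForbidden G w → u ≢ w → G u w ≡ false →
    (∃ λ (k : ℕ) → Nullity G k × Nullity (addEdge G u w) k)
      ⇔ (∀ (v : Fin n) → Core G v ⇔ Core (addEdge G u w) v)
mainTheorem20 n G u w _ _ _ u-forbidden w-forbidden _ _ = mk⇔ sameCore sameNullity
  where
  G+e : Graph n
  G+e = addEdge G u w

  Ker⊆ : Ker G ⊆ Ker G+e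
  Ker⊆ = Ker⊆Ker-addEdge G u-forbidden w-forbidden

  sameCore : (∃ λ k → Nullity G k × Nullity G+e k) → ∀ v → Core G v ⇔ Core G+e v
  sameCore (k , ν , ν+e) =
    Core-cong G G+e (Ker⊆ , ⊆∧equal-dim⇒⊇ {R = A G} basis (IsBasis.spans basis+e) Ker⊆)
    where
    basis : IsBasis (Ker G) _
    basis = proj₂ (to (Nullity⇔basis G k) ν)
    basis+e : IsBasis (Ker G+e) _
    basis+e = proj₂ (to (Nullity⇔basis G+e k) ν+e)

  sameNullity : (∀ v → Core G v ⇔ Core G+e v) → ∃ λ k → Nullity G k × Nullity G+e k
  sameNullity sameCore with solutionBasis n (A G)
  ... | k , b , _ , β =
    k , from (Nullity⇔basis G k) (b , β) , from (Nullity⇔basis G+e k) (b , IsBasis-cong Ker≐ β)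
    where
    Ker≐ : Ker G ≐ Ker G+e
    Ker≐ = Ker⊆ , Ker-addEdge⊆Ker G (u-forbidden ∘ from (sameCore u)) (w-forbidden ∘ from (sameCore w))
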